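{- Let $\mathfrak T$ be a tower type of degree $n$ and let $0<i,j$ with $i+j<n$. The following are equivalent: (1) the addition $i+j$ does not overflow modulo $\mathfrak T$; (2) $(i,j)$ is a corner of $T(\mathfrak T)$; (3) $T(\mathfrak T)(i,j)=i+j$.
   Context: Let $[n]=\{0,\dots,n-1\}$. A tower type of degree $n$ is a tuple $\mathfrak T=(n_1,\dots,n_t)$ of integers $>1$ with product $n$. Each $m\in[n]$ is written uniquely in mixed radix notation $m=m_1+m_2n_1+\cdots+m_tn_1\cdots n_{t-1}$ with $0\le m_s<n_s$. For $i,j$ with $i+j<n$, writing $i,j$ and $k=i+j$ this way, the addition $i+j$ does not overflow modulo $\mathfrak T$ if $i_s+j_s=k_s$ for all $s$, and overflows otherwise. Let $H=C_{n_1}\times\cdots\times C_{n_t}$ (written multiplicatively), $e_s$ a generator of the $s$-th factor, $v_m=e_1^{m_1}\cdots e_t^{m_t}$, $F_m=\{v_0,\dots,v_m\}$; $T(\mathfrak T):[n]\times[n]\to[n]$ is $T(\mathfrak T)(i,j)=\min\{k: F_iF_j\subseteq F_k\}$ with $F_iF_j$ the set of products. For a function $T:[n]\times[n]\to[n]$ and $0<i,j<n$, $(i,j)$ is a corner of $T$ if $T(i-1,j)<T(i,j)$ and $T(i,j-1)<T(i,j)$. -}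

module Defs where

open import Data.Nat using (ℕ; zero; suc; _+_; _∸_; _<_; _≤_)
open import Data.Nat.DivMod using (_%_; _/_)
open import Data.List using (List; []; _∷_; zipWith)
open import Data.List.Properties using (≡-dec)
open import Data.Fin using (Fin; toℕ)
open import Data.Fin.Properties using (all?; any?)
open import Data.Product using (Σ; _×_)
open import Relation.Binary.PropositionalEquality using (_≡_)
open import Relation.Nullary using (Dec; yes; no)
import Data.Nat as ℕ

-- A tower type is a list ts = (n₁,…,nₜ) of naturals; the statement additionally
-- assumes every entry is > 1 and their product is n.

-- Mixed radix digits (m₁,…,mₜ) of m with respect to ts:
-- m₁ = m mod n₁, and the rest are the digits of ⌊m / n₁⌋ for (n₂,…,nₜ).
-- (The zero-radix clause is junk, excluded by the hypothesis that all nₛ > 1.)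
digits : List ℕ → ℕ → List ℕ
digits []            m = []
digits (zero ∷ ts)   m = 0 ∷ digits ts m
digits (suc b ∷ ts)  m = (m % suc b) ∷ digits ts (m / suc b)

NoOverflow : List ℕ → ℕ → ℕ → Set
NoOverflow ts i j = zipWith _+_ (digits ts i) (digits ts j) ≡ digits ts (i + j)

-- The group H = C_{n₁} × ⋯ × C_{nₜ}, elements represented by exponent tuples;
-- group multiplication is componentwise addition of exponents modulo nₛ.
mulH : List ℕ → List ℕ → List ℕ → List ℕ
mulH []           _        _        = []
mulH (_ ∷ _)      []       _        = []
mulH (_ ∷ _)      (_ ∷ _)  []       = []
mulH (zero ∷ ts)  (x ∷ xs) (y ∷ ys) = (x + y) ∷ mulH ts xs ys
mulH (suc b ∷ ts) (x ∷ xs) (y ∷ ys) = ((x + y) % suc b) ∷ mulH ts xs ys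

-- v_m = e₁^{m₁} ⋯ eₜ^{mₜ}
v : List ℕ → ℕ → List ℕ
v ts m = digits ts m

-- F_i F_j ⊆ F_k, where F_m = {v₀,…,v_m}.
ProdSub : List ℕ → ℕ → ℕ → ℕ → Set
ProdSub ts i j k =
  (a : Fin (suc i)) (b : Fin (suc j)) →
  Σ (Fin (suc k)) λ c → mulH ts (v ts (toℕ a)) (v ts (toℕ b)) ≡ v ts (toℕ c)

prodSub? : ∀ ts i j k → Dec (ProdSub ts i j k)
prodSub? ts i j k = all? λ a → all? λ b → any? λ c →
  ≡-dec ℕ._≟_ (mulH ts (v ts (toℕ a)) (v ts (toℕ b))) (v ts (toℕ c))

-- Least k in [start, start + fuel] with F_i F_j ⊆ F_k (returns start + fuel if none).
searchT : List ℕ → ℕ → ℕ → (fuel start : ℕ) → ℕ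
searchT ts i j zero     start = start
searchT ts i j (suc f)  start with prodSub? ts i j start
... | yes _ = start
... | no  _ = searchT ts i j f (suc start)

-- T(𝔗)(i,j) = min { k ∈ [n] : F_i F_j ⊆ F_k }.
-- (F_{n-1} = H, so the minimum exists and the search over [0, n-1] finds it.)
Tower-T : (ts : List ℕ) (n : ℕ) → ℕ → ℕ → ℕ
Tower-T ts n i j = searchT ts i j (n ∸ 1) 0

Corner : (ℕ → ℕ → ℕ) → ℕ → ℕ → Set
Corner T i j = (T (i ∸ 1) j < T i j) × (T i (j ∸ 1) < T i j)

{-# OPTIONS --safe #-}
module Submission where

open import Defs
open import Data.Nat using (ℕ; _+_; _<_)
open import Data.List using (List)
open import Data.Nat.ListAction using (product)
open import Data.List.Relation.Unary.All using (All)
open import Data.Product using (_×_)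
open import Function.Bundles using (_⇔_)
open import Relation.Binary.PropositionalEquality using (_≡_)

open import Data.Nat using (suc; _*_; _∸_; _≤_; z≤n; s≤s; _<?_; _≟_)
open import Data.Nat.Properties
open import Data.Nat.DivMod
open import Data.Nat.Divisibility using (n∣m*n)
open import Data.Nat.Solver using (module +-*-Solver)
open import Data.List using ([]; _∷_; zipWith)
open import Data.List.Properties using (≡-dec; ∷-injective)
open import Data.List.Relation.Unary.All using ([]; _∷_)
import Data.List.Relation.Unary.All as All
open import Data.Fin using (toℕ; fromℕ<)
open import Data.Fin.Properties using (toℕ≤pred[n]; toℕ-fromℕ<)
open import Data.Product using (∃-syntax; _,_; proj₁; proj₂)
open import Data.Sum using (inj₁; inj₂)
open import Data.Empty using (⊥-elim)
open import Function.Base using (_∘_)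
open import Function.Bundles using (mk⇔)
open import Relation.Nullary using (yes; no; ¬_)
open import Relation.Nullary.Decidable using (decidable-stable)
open import Relation.Binary.PropositionalEquality using (refl; sym; trans; cong; cong₂; subst; subst₂; module ≡-Reasoning)

-- The map m ↦ v_m is injective on [n], and a product v_a v_c can always be
-- written as v_{a′+c′} with a′ ≤ a, c′ ≤ c and a′ + c′ free of overflow:
-- digitwise, keep the digits (x, y) if x + y < n_s and replace them by
-- (x + y − n_s, 0) otherwise.  Hence F_i F_j ⊆ F_{i+j}, and if i + j does not
-- overflow then v_i v_j = v_{i+j} forces T(i,j) = i + j, which is a corner
-- since T(i−1,j) ≤ i−1+j and T(i,j−1) ≤ i+j−1.  If i + j overflows, every
-- product v_a v_c with a ≤ i, c ≤ j is some carry-free v_{a′+c′} with a′ < i or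
-- c′ < j, so it already lies in F_{T(i−1,j)} or F_{T(i,j−1)}, whence
-- T(i,j) ≤ max(T(i−1,j), T(i,j−1)).

%-+*-< : ∀ {b} r q → r < suc b → (r + q * suc b) % suc b ≡ r
%-+*-< {b} r q r<B = trans ([m+kn]%n≡m%n r q (suc b)) (m<n⇒m%n≡m r<B)

/-+*-< : ∀ {b} r q → r < suc b → (r + q * suc b) / suc b ≡ q
/-+*-< {b} r q r<B = trans (+-distrib-/-∣ʳ r (n∣m*n q))
  (cong₂ _+_ (m<n⇒m/n≡0 r<B) (m*n/n≡m q (suc b)))

digits-+* : ∀ {b} ts r q → r < suc b → digits (suc b ∷ ts) (r + q * suc b) ≡ r ∷ digits ts q
digits-+* ts r q r<B rewrite %-+*-< r q r<B | /-+*-< r q r<B = refl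

+*-≤ : ∀ {b} a r q → r ≤ a % suc b → q ≤ a / suc b → r + q * suc b ≤ a
+*-≤ {b} a r q r≤ q≤ = subst (r + q * suc b ≤_) (sym (m≡m%n+[m/n]*n a (suc b)))
  (+-mono-≤ r≤ (*-monoˡ-≤ (suc b) q≤))

+*-< : ∀ {b p} r q → r < suc b → q < p → r + q * suc b < suc b * p
+*-< {b} {p} r q r<B q<p = begin-strict
  r + q * suc b      <⟨ +-monoˡ-< (q * suc b) r<B ⟩
  suc q * suc b      ≤⟨ *-monoˡ-≤ (suc b) q<p ⟩
  p * suc b          ≡⟨ *-comm p (suc b) ⟩
  suc b * p          ∎
  where open ≤-Reasoning

digits-injective : ∀ ts → All (0 <_) ts → ∀ {a c} → a < product ts → c < product ts →
  digits ts a ≡ digits ts c → a ≡ c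
digits-injective [] [] {0} {0} _ _ _ = refl
digits-injective [] [] {0} {suc _} _ (s≤s ()) _
digits-injective [] [] {suc _} (s≤s ()) _ _
digits-injective (suc b ∷ ts) (_ ∷ ps) {a} {c} a<n c<n eq = begin
  a                      ≡⟨ m≡m%n+[m/n]*n a B ⟩
  a % B + (a / B) * B    ≡⟨ cong₂ (λ r q → r + q * B) (proj₁ (∷-injective eq)) quotients-eq ⟩
  c % B + (c / B) * B    ≡⟨ m≡m%n+[m/n]*n c B ⟨
  c                      ∎
  where
  open ≡-Reasoning
  B = suc b
  quotient-< : ∀ {m} → m < B * product ts → m / B < product ts
  quotient-< {m} m<n = m<n*o⇒m/o<n (subst (m <_) (*-comm B (product ts)) m<n)
  quotients-eq : a / B ≡ c / B
  quotients-eq = digits-injective ts ps (quotient-< a<n) (quotient-< c<n) (proj₂ (∷-injective eq))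

mulH-noOverflow : ∀ ts a c → NoOverflow ts a c → mulH ts (v ts a) (v ts c) ≡ v ts (a + c)
mulH-noOverflow [] a c _ = refl
mulH-noOverflow (0 ∷ ts) a c eq = cong (0 ∷_) (mulH-noOverflow ts a c (proj₂ (∷-injective eq)))
mulH-noOverflow (suc b ∷ ts) a c eq = cong₂ _∷_ low-digit high-digits
  where
  B = suc b
  low-eq : a % B + c % B ≡ (a + c) % B
  low-eq = proj₁ (∷-injective eq)
  quotient-+ : (a + c) / B ≡ a / B + c / B
  quotient-+ = +-distrib-/ a c (subst (_< B) (sym low-eq) (m%n<n (a + c) B))
  low-digit : (a % B + c % B) % B ≡ (a + c) % B
  low-digit = trans (cong (_% B) low-eq) (m%n%n≡m%n (a + c) B)
  high-digits : mulH ts (v ts (a / B)) (v ts (c / B)) ≡ v ts ((a + c) / B)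
  high-digits = trans
    (mulH-noOverflow ts (a / B) (c / B) (trans (proj₂ (∷-injective eq)) (cong (digits ts) quotient-+)))
    (cong (digits ts) (sym quotient-+))

carryFreeDigits : ∀ {b} x y → x < suc b → y < suc b →
  ∃[ r ] ∃[ s ] r ≤ x × s ≤ y × r + s < suc b × (x + y) % suc b ≡ r + s
carryFreeDigits {b} x y x<B y<B with x + y <? suc b
... | yes x+y<B = x , y , ≤-refl , ≤-refl , x+y<B , m<n⇒m%n≡m x+y<B
... | no x+y≮B = x + y ∸ B , 0 , r≤x , z≤n , r<B′ , r≡[x+y]%B
  where
  B = suc b
  B≤x+y : B ≤ x + y
  B≤x+y = ≮⇒≥ x+y≮B
  r≤x : x + y ∸ B ≤ x
  r≤x = subst (x + y ∸ B ≤_) (m+n∸n≡m x y) (∸-monoʳ-≤ (x + y) (<⇒≤ y<B))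
  r<B : x + y ∸ B < B
  r<B = +-cancelʳ-< B (x + y ∸ B) B
    (subst (_< B + B) (sym (m∸n+n≡m B≤x+y)) (+-mono-< x<B y<B))
  r<B′ : x + y ∸ B + 0 < B
  r<B′ = subst (_< B) (sym (+-identityʳ _)) r<B
  r≡[x+y]%B : (x + y) % B ≡ x + y ∸ B + 0
  r≡[x+y]%B = trans (sym (m≤n⇒[n∸m]%m≡n%m B≤x+y))
    (trans (m<n⇒m%n≡m r<B) (sym (+-identityʳ _)))

record CarryFreeSplit (ts : List ℕ) (a c : ℕ) : Set where
  constructor carryFreeSplit
  field
    a′ c′ : ℕ
    a′≤a : a′ ≤ a
    c′≤c : c′ ≤ c
    carry-free : NoOverflow ts a′ c′
    mulH≡v : mulH ts (v ts a) (v ts c) ≡ v ts (a′ + c′)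
    a′+c′<n : a′ + c′ < product ts

carryFreeSplit-∷ : ∀ {b ts a c} → CarryFreeSplit ts (a / suc b) (c / suc b) → CarryFreeSplit (suc b ∷ ts) a c
carryFreeSplit-∷ {b} {ts} {a} {c} (carryFreeSplit A C A≤ C≤ carry-free mulH≡v A+C<n)
  with carryFreeDigits (a % suc b) (c % suc b) (m%n<n a (suc b)) (m%n<n c (suc b))
... | r , s , r≤ , s≤ , r+s<B , low-digit =
  carryFreeSplit (r + A * B) (s + C * B) (+*-≤ a r A r≤ A≤) (+*-≤ c s C s≤ C≤)
    (trans (cong₂ (zipWith _+_) (digits-+* ts r A r<B) (digits-+* ts s C s<B))
           (trans (cong ((r + s) ∷_) carry-free) (sym sum-digits)))
    (trans (cong₂ _∷_ low-digit mulH≡v) (sym sum-digits))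
    (subst (_< B * product ts) (sym sum-regroup) (+*-< (r + s) (A + C) r+s<B A+C<n))
  where
  open +-*-Solver
  B = suc b
  r<B : r < B
  r<B = ≤-<-trans (m≤m+n r s) r+s<B
  s<B : s < B
  s<B = ≤-<-trans (m≤n+m s r) r+s<B
  sum-regroup : (r + A * B) + (s + C * B) ≡ (r + s) + (A + C) * B
  sum-regroup = solve 5 (λ r s A C B → (r :+ A :* B) :+ (s :+ C :* B) := (r :+ s) :+ (A :+ C) :* B)
    refl r s A C B
  sum-digits : digits (B ∷ ts) ((r + A * B) + (s + C * B)) ≡ (r + s) ∷ digits ts (A + C)
  sum-digits = trans (cong (digits (B ∷ ts)) sum-regroup) (digits-+* ts (r + s) (A + C) r+s<B)

carryFreeSplit-all : ∀ ts → All (0 <_) ts → ∀ a c → CarryFreeSplit ts a c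
carryFreeSplit-all [] [] a c = carryFreeSplit 0 0 z≤n z≤n refl refl (s≤s z≤n)
carryFreeSplit-all (suc b ∷ ts) (_ ∷ ps) a c =
  carryFreeSplit-∷ (carryFreeSplit-all ts ps (a / suc b) (c / suc b))

Covered : List ℕ → ℕ → ℕ → ℕ → Set
Covered ts i j k = ∀ {a c} → a ≤ i → c ≤ j → ∃[ d ] d ≤ k × mulH ts (v ts a) (v ts c) ≡ v ts d

Covered⇒ProdSub : ∀ {ts i j k} → Covered ts i j k → ProdSub ts i j k
Covered⇒ProdSub {ts} cov a b with cov (toℕ≤pred[n] a) (toℕ≤pred[n] b)
... | d , d≤k , eq = fromℕ< (s≤s d≤k) , trans eq (cong (v ts) (sym (toℕ-fromℕ< (s≤s d≤k))))

ProdSub⇒Covered : ∀ {ts i j k} → ProdSub ts i j k → Covered ts i j k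
ProdSub⇒Covered {ts} ps {a} {c} a≤i c≤j with ps (fromℕ< (s≤s a≤i)) (fromℕ< (s≤s c≤j))
... | d , eq = toℕ d , toℕ≤pred[n] d ,
  subst₂ (λ x y → mulH ts (v ts x) (v ts y) ≡ v ts (toℕ d))
    (toℕ-fromℕ< (s≤s a≤i)) (toℕ-fromℕ< (s≤s c≤j)) eq

covered-by-carryFree : ∀ {ts i j k} → All (0 <_) ts →
  (∀ {a c} → a ≤ i → c ≤ j → NoOverflow ts a c → a + c < product ts →
    ∃[ d ] d ≤ k × v ts (a + c) ≡ v ts d) →
  Covered ts i j k
covered-by-carryFree {ts} ps cov {a} {c} a≤i c≤j with carryFreeSplit-all ts ps a c
... | carryFreeSplit a′ c′ a′≤a c′≤c carry-free mulH≡v a′+c′<n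
  with cov (≤-trans a′≤a a≤i) (≤-trans c′≤c c≤j) carry-free a′+c′<n
...   | d , d≤k , v≡v = d , d≤k , trans mulH≡v v≡v

searchT-least : ∀ ts i j f s {k} → ProdSub ts i j k → s ≤ k → searchT ts i j f s ≤ k
searchT-least ts i j 0 s _ s≤k = s≤k
searchT-least ts i j (suc f) s p s≤k with prodSub? ts i j s
... | yes _ = s≤k
... | no ¬p with m≤n⇒m<n∨m≡n s≤k
...   | inj₁ s<k = searchT-least ts i j f (suc s) p s<k
...   | inj₂ refl = ⊥-elim (¬p p)

searchT-sound : ∀ ts i j f s → ProdSub ts i j (s + f) → ProdSub ts i j (searchT ts i j f s)
searchT-sound ts i j 0 s p = subst (ProdSub ts i j) (+-identityʳ s) p
searchT-sound ts i j (suc f) s p with prodSub? ts i j s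
... | yes q = q
... | no _ = searchT-sound ts i j f (suc s) (subst (ProdSub ts i j) (+-suc s f) p)

module TowerT (ts : List ℕ) (ps : All (0 <_) ts) where

  n : ℕ
  n = product ts

  T : ℕ → ℕ → ℕ
  T = Tower-T ts n

  T-covers : ∀ i j → Covered ts i j (T i j)
  T-covers i j = ProdSub⇒Covered (searchT-sound ts i j (n ∸ 1) 0 (Covered⇒ProdSub H-covered))
    where
    H-covered : Covered ts i j (n ∸ 1)
    H-covered = covered-by-carryFree ps λ {a} {c} _ _ _ a+c<n → a + c , <⇒≤pred a+c<n , refl

  T-least : ∀ {i j k} → Covered ts i j k → T i j ≤ k
  T-least {i} {j} cov = searchT-least ts i j (n ∸ 1) 0 (Covered⇒ProdSub cov) z≤n

  T≤i+j : ∀ i j → T i j ≤ i + j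
  T≤i+j i j = T-least (covered-by-carryFree ps λ {a} {c} a≤i c≤j _ _ →
    a + c , +-mono-≤ a≤i c≤j , refl)

  noOverflow⇒T≡i+j : ∀ {i j} → i + j < n → NoOverflow ts i j → T i j ≡ i + j
  noOverflow⇒T≡i+j {i} {j} i+j<n carry-free with T-covers i j ≤-refl ≤-refl
  ... | d , d≤T , mulH≡v = ≤-antisym (T≤i+j i j) (subst (_≤ T i j) (sym i+j≡d) d≤T)
    where
    i+j≡d : i + j ≡ d
    i+j≡d = digits-injective ts ps i+j<n (≤-<-trans d≤T (≤-<-trans (T≤i+j i j) i+j<n))
      (trans (sym (mulH-noOverflow ts i j carry-free)) mulH≡v)

  T≡i+j⇒corner : ∀ {i j} → 0 < i → 0 < j → T i j ≡ i + j → Corner T i j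
  T≡i+j⇒corner {suc i} {suc j} _ _ T≡i+j rewrite T≡i+j =
    s≤s (T≤i+j i (suc j)) , s≤s (subst (T (suc i) j ≤_) (sym (+-suc i j)) (T≤i+j (suc i) j))

  overflow⇒¬corner : ∀ {i j} → ¬ NoOverflow ts i j → ¬ Corner T i j
  overflow⇒¬corner {i} {j} overflow (T[i-1,j]<T , T[i,j-1]<T) =
    <-irrefl refl (≤-<-trans (T-least (covered-by-carryFree ps below-corner)) (pred< T[i-1,j]<T))
    where
    pred< : ∀ {m k} → m < k → k ∸ 1 < k
    pred< {k = suc k} _ = n<1+n k
    T-1 : ℕ
    T-1 = T i j ∸ 1
    via : ∀ {i′ j′ a c} → T i′ j′ < T i j → a ≤ i′ → c ≤ j′ → NoOverflow ts a c →
      ∃[ d ] d ≤ T-1 × v ts (a + c) ≡ v ts d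
    via {i′} {j′} T′<T a≤ c≤ carry-free with T-covers i′ j′ a≤ c≤
    ... | d , d≤T′ , mulH≡v = d , ≤-trans d≤T′ (<⇒≤pred T′<T) ,
      trans (sym (mulH-noOverflow ts _ _ carry-free)) mulH≡v
    below-corner : ∀ {a c} → a ≤ i → c ≤ j → NoOverflow ts a c → a + c < n →
      ∃[ d ] d ≤ T-1 × v ts (a + c) ≡ v ts d
    below-corner a≤i c≤j carry-free _ with m≤n⇒m<n∨m≡n a≤i | m≤n⇒m<n∨m≡n c≤j
    ... | inj₁ a<i | _ = via T[i-1,j]<T (<⇒≤pred a<i) c≤j carry-free
    ... | inj₂ _ | inj₁ c<j = via T[i,j-1]<T a≤i (<⇒≤pred c<j) carry-free
    ... | inj₂ refl | inj₂ refl = ⊥-elim (overflow carry-free)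

  corner⇒noOverflow : ∀ {i j} → Corner T i j → NoOverflow ts i j
  corner⇒noOverflow corner =
    decidable-stable (≡-dec _≟_ _ _) (λ overflow → overflow⇒¬corner overflow corner)

corollary1p23 : (ts : List ℕ) (n : ℕ) → All (1 <_) ts → product ts ≡ n →
    (i j : ℕ) → 0 < i → 0 < j → i + j < n →
    (NoOverflow ts i j ⇔ Corner (Tower-T ts n) i j)
    × (Corner (Tower-T ts n) i j ⇔ Tower-T ts n i j ≡ i + j)
corollary1p23 ts .(product ts) ps refl i j 0<i 0<j i+j<n =
  mk⇔ (T≡i+j⇒corner 0<i 0<j ∘ noOverflow⇒T≡i+j i+j<n) corner⇒noOverflow ,
  mk⇔ (noOverflow⇒T≡i+j i+j<n ∘ corner⇒noOverflow) (T≡i+j⇒corner 0<i 0<j)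
  where open TowerT ts (All.map <⇒≤ ps)
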